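{- For a connected graph $G$ and an integer $r$ with $1 \le r \le md(G)$, there is an MD-coloring $\Gamma$ of $G$ using exactly $r$ colors.
   Context: An edge-coloring of a graph $G$ is a map $\Gamma: E(G) \to [k]$ (adjacent edges may receive the same color); $|\Gamma|$ is the number of colors used. An edge-cut is monochromatic if all of its edges have the same color. An edge-coloring is a monochromatic disconnection coloring (MD-coloring) if any two distinct vertices $u,v$ are separated by a monochromatic edge-cut (equivalently, for some color $i$, $u$ and $v$ lie in different components of the graph obtained by deleting all edges of color $i$). For a connected graph $G$, $md(G)$ is the maximum number of colors in an MD-coloring of $G$. -}

module Defs where

open import Data.Nat using (ℕ; _≤_)
open import Data.Fin using (Fin)
open import Data.Product using (_×_; _,_; ∃)
open import Data.Sum using (_⊎_)
open import Data.Unit using (⊤)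
open import Relation.Binary.PropositionalEquality using (_≡_; _≢_)
open import Relation.Nullary using (¬_)

record Graph : Set where
  field
    n        : ℕ
    m        : ℕ
    end₁     : Fin m → Fin n
    end₂     : Fin m → Fin n
    loopless : ∀ e → end₁ e ≢ end₂ e
    simple   : ∀ e f → e ≢ f →
               ¬ ((end₁ e ≡ end₁ f × end₂ e ≡ end₂ f) ⊎
                  (end₁ e ≡ end₂ f × end₂ e ≡ end₁ f))

open Graph public

-- Reach G A u v : u and v are joined by a walk in the spanning subgraph of G
-- consisting of the edges satisfying A (i.e. same component of that subgraph).
data Reach (G : Graph) (A : Fin (m G) → Set) : Fin (n G) → Fin (n G) → Set where
  here  : ∀ {u} → Reach G A u u
  step₁ : ∀ {v} e → A e → Reach G A (end₂ G e) v → Reach G A (end₁ G e) v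
  step₂ : ∀ {v} e → A e → Reach G A (end₁ G e) v → Reach G A (end₂ G e) v

Connected : Graph → Set
Connected G = ∀ u v → Reach G (λ _ → ⊤) u v

-- An edge-colouring with colour set [k] (here Fin k); adjacent edges may share colours.
Colouring : Graph → ℕ → Set
Colouring G k = Fin (m G) → Fin k

UsesExactly : (G : Graph) (k : ℕ) → Colouring G k → Set
UsesExactly G k Γ = ∀ (c : Fin k) → ∃ λ e → Γ e ≡ c

IsMD : (G : Graph) (k : ℕ) → Colouring G k → Set
IsMD G k Γ = ∀ u v → u ≢ v → ∃ λ (i : Fin k) → ¬ Reach G (λ e → Γ e ≢ i) u v

HasMDWith : Graph → ℕ → Set
HasMDWith G k = ∃ λ (Γ : Colouring G k) → UsesExactly G k Γ × IsMD G k Γ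

MDNumber : Graph → ℕ → Set
MDNumber G k = HasMDWith G k × (∀ j → HasMDWith G j → j ≤ k)

module Submission where

-- Idea: the set of colour counts achievable by MD-colourings is closed downwards
-- (above 1).  Take an MD-colouring Γ with k colours and merge colours: compose Γ
-- with a surjection f : Fin k → Fin r.  The result still uses every colour, since
-- f is onto; and it is still MD, since deleting all edges of colour f i deletes
-- (at least) every edge of colour i, so a separation for Γ by colour i is a
-- separation for f ∘ Γ by colour f i.

open import Defs
open import Data.Nat using (ℕ; _≤_; _⊓_; suc; s≤s)
open import Data.Nat.Properties using (m≤n⇒m⊓n≡m; m⊓n≤n; ≤-pred)
open import Data.Product using (_,_)
open import Data.Fin using (Fin; toℕ; fromℕ<; inject≤)
open import Data.Fin.Properties using (toℕ-inject≤; toℕ-fromℕ<; toℕ-injective; toℕ<n)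
open import Relation.Binary.PropositionalEquality using (_≡_; _≢_; cong; trans; module ≡-Reasoning)

reach-mono : ∀ {G} {A B : Fin (m G) → Set} → (∀ e → A e → B e) →
             ∀ {u v} → Reach G A u v → Reach G B u v
reach-mono A⊆B here            = here
reach-mono A⊆B (step₁ e a uv) = step₁ e (A⊆B e a) (reach-mono A⊆B uv)
reach-mono A⊆B (step₂ e a uv) = step₂ e (A⊆B e a) (reach-mono A⊆B uv)

recolour-IsMD : ∀ G {k j} (f : Fin k → Fin j) (Γ : Colouring G k) →
                IsMD G k Γ → IsMD G j (λ e → f (Γ e))
recolour-IsMD G f Γ md u v u≢v with md u v u≢v
... | i , unreachable = f i , λ uv → unreachable (reach-mono avoids uv)
  where
  avoids : ∀ e → f (Γ e) ≢ f i → Γ e ≢ i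
  avoids e fΓe≢fi Γe≡i = fΓe≢fi (cong f Γe≡i)

recolour-UsesExactly : ∀ G {k j} (f : Fin k → Fin j) (s : Fin j → Fin k) →
                       (∀ c → f (s c) ≡ c) → (Γ : Colouring G k) →
                       UsesExactly G k Γ → UsesExactly G j (λ e → f (Γ e))
recolour-UsesExactly G f s fs≡id Γ uses c with uses (s c)
... | e , Γe≡sc = e , trans (cong f Γe≡sc) (fs≡id c)

clamp : ∀ {k} r → Fin k → Fin (suc r)
clamp r c = fromℕ< (s≤s (m⊓n≤n (toℕ c) r))

clamp-inject≤ : ∀ {k} r (le : suc r ≤ k) (c : Fin (suc r)) → clamp r (inject≤ c le) ≡ c
clamp-inject≤ r le c = toℕ-injective (begin
  toℕ (clamp r (inject≤ c le)) ≡⟨ toℕ-fromℕ< _ ⟩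
  toℕ (inject≤ c le) ⊓ r       ≡⟨ cong (_⊓ r) (toℕ-inject≤ c le) ⟩
  toℕ c ⊓ r                    ≡⟨ m≤n⇒m⊓n≡m (≤-pred (toℕ<n c)) ⟩
  toℕ c                        ∎)
  where open ≡-Reasoning

HasMDWith-down : ∀ G {k} r → HasMDWith G k → suc r ≤ k → HasMDWith G (suc r)
HasMDWith-down G r (Γ , uses , md) le =
  (λ e → clamp r (Γ e)) ,
  recolour-UsesExactly G (clamp r) (λ c → inject≤ c le) (clamp-inject≤ r le) Γ uses ,
  recolour-IsMD G (clamp r) Γ md

lemma2p5 : (G : Graph) → Connected G → (mdG : ℕ) → MDNumber G mdG →
    (r : ℕ) → 1 ≤ r → r ≤ mdG → HasMDWith G r
lemma2p5 G _ mdG (attained , _) (suc r) _ r≤mdG = HasMDWith-down G r attained r≤mdG
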